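{- Let $(G,\mathcal C)$ be an edge-colored graph with conflict graph $H$ and color-intersection graph $\Gamma$. Let $\Gamma_1,\dots,\Gamma_t$ be the connected components of $\Gamma$ and $H_1,\dots,H_t$ the induced subgraphs of $H$ on the edges whose colors lie in $\Gamma_1,\dots,\Gamma_t$ respectively. Then $H$ is the disjoint union $H_1\sqcup\cdots\sqcup H_t$, and $\kappa(G,\mathcal C)=\sum_{i=1}^t\kappa_i$, where $\kappa$ is the chordal deletion number and $\kappa_i$ is the chordal deletion number of the instance restricted to the colors of $\Gamma_i$.
   Context: An edge-colored graph $(G,\mathcal C)$: finite simple graph $G=(V,E)$ with a partition $\mathcal C$ of $E$ into color classes. Conflict graph $H$: vertex set $E$, $e\ne f$ adjacent iff they share an endpoint or have the same color. Color-intersection graph $\Gamma$: vertex set $\mathcal C$, two distinct colors adjacent iff some edge of one color shares an endpoint with some edge of the other. $S(F)$: edges with colors in $F$. The chordal deletion number $\kappa(G,\mathcal C)$ is the minimum $|F|$ over $F\subseteq\mathcal C$ such that $H-S(F)$ is chordal. -}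

module Defs where

open import Data.Nat using (ℕ; zero; suc; _≤_)
open import Data.Fin using (Fin; toℕ)
open import Data.Fin.Subset using (Subset; _∈_; _∉_; ∣_∣)
open import Data.Product using (Σ; ∃; ∃-syntax; _×_; proj₁; proj₂)
open import Data.Sum using (_⊎_)
open import Relation.Nullary using (¬_)
open import Relation.Binary.PropositionalEquality using (_≡_; _≢_)
open import Relation.Binary.Construct.Closure.ReflexiveTransitive using (Star)

-- An edge-coloured finite simple graph with vertex set Fin n, edge set Fin m,
-- and colour classes indexed by Fin k.  'col' assigns to each edge its class;
-- surjectivity of 'col' makes {col⁻¹(a)} a partition of E into nonempty classes.
record EdgeColoredGraph (n m k : ℕ) : Set where
  field
    ends      : Fin m → Fin n × Fin n
    loopless  : ∀ e → proj₁ (ends e) ≢ proj₂ (ends e)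
    noParallel : ∀ e f → (proj₁ (ends e) ≡ proj₁ (ends f) × proj₂ (ends e) ≡ proj₂ (ends f))
                       ⊎ (proj₁ (ends e) ≡ proj₂ (ends f) × proj₂ (ends e) ≡ proj₁ (ends f))
                       → e ≡ f
    col       : Fin m → Fin k
    colSurj   : ∀ a → ∃[ e ] col e ≡ a

module _ {n m k : ℕ} (G : EdgeColoredGraph n m k) where
  open EdgeColoredGraph G

  Incident : Fin n → Fin m → Set
  Incident x e = proj₁ (ends e) ≡ x ⊎ proj₂ (ends e) ≡ x

  ShareEnd : Fin m → Fin m → Set
  ShareEnd e f = ∃[ x ] (Incident x e × Incident x f)

  Conflict : Fin m → Fin m → Set
  Conflict e f = e ≢ f × (ShareEnd e f ⊎ col e ≡ col f)

  ColorAdj : Fin k → Fin k → Set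
  ColorAdj a b = a ≢ b × ∃[ e ] ∃[ f ] (col e ≡ a × col f ≡ b × ShareEnd e f)

  ColorConnected : Fin k → Fin k → Set
  ColorConnected = Star ColorAdj

Consec : {l : ℕ} → Fin l → Fin l → Set
Consec {l} i j = toℕ j ≡ suc (toℕ i) ⊎ (suc (toℕ i) ≡ l × toℕ j ≡ 0)

record Cycle {V : Set} (adj : V → V → Set) (keep : V → Set) : Set where
  field
    len    : ℕ
    len≥4  : 4 ≤ len
    vtx    : Fin len → V
    inj    : ∀ i j → vtx i ≡ vtx j → i ≡ j
    kept   : ∀ i → keep (vtx i)
    edges  : ∀ i j → Consec i j → adj (vtx i) (vtx j)

HasChord : {V : Set} {adj : V → V → Set} {keep : V → Set} → Cycle adj keep → Set
HasChord {adj = adj} c = ∃[ i ] ∃[ j ] (i ≢ j × ¬ Consec i j × ¬ Consec j i × adj (vtx i) (vtx j))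
  where open Cycle c

InducedChordal : {V : Set} (adj : V → V → Set) (keep : V → Set) → Set
InducedChordal adj keep = (c : Cycle adj keep) → HasChord c

-- Chordal deletion number of the instance restricted to the colours in D
-- (D = all colours gives κ(G,𝒞)).  The conflict graph of the restricted
-- instance is the induced subgraph H[S(D)], so H_D − S(F) = H[S(D ∖ F)].
-- κ is the minimum of |F| over F ⊆ D with H_D − S(F) chordal.
module _ {n m k : ℕ} (G : EdgeColoredGraph n m k) where
  open EdgeColoredGraph G

  DeletionWorks : (D : Fin k → Set) → Subset k → Set
  DeletionWorks D F = (∀ a → a ∈ F → D a)
                    × InducedChordal (Conflict G) (λ e → D (col e) × col e ∉ F)

  IsChordalDeletionNumber : (D : Fin k → Set) → ℕ → Set
  IsChordalDeletionNumber D κ =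
      (∃[ F ] (DeletionWorks D F × ∣ F ∣ ≡ κ))
    × (∀ F → DeletionWorks D F → κ ≤ ∣ F ∣)

  IsComponentLabelling : (t : ℕ) → (Fin k → Fin t) → Set
  IsComponentLabelling t comp =
      (∀ i → ∃[ a ] comp a ≡ i)
    × (∀ a b → comp a ≡ comp b → ColorConnected G a b)
    × (∀ a b → ColorConnected G a b → comp a ≡ comp b)

-- Two conflicting edges either share a colour or share an endpoint, and in the
-- latter case their colours are adjacent in Γ; so every edge of H joins two
-- edges whose colours lie in the same component of Γ, and H is the disjoint
-- union of the H_i.  Consequently every cycle of H lies in a single H_i, so a
-- deletion set is valid for H exactly when each of its parts F ∩ Γ_i is valid
-- for H_i.  Gluing optimal deletion sets of the H_i gives κ ≤ Σ κ_i, and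
-- splitting an optimal deletion set of H gives Σ κ_i ≤ κ.
module Submission where

open import Defs
open import Data.Nat using (ℕ; zero; suc; _≤_; _+_; z≤n; s≤s)
open import Data.Nat.Properties
  using (+-0-commutativeMonoid; +-identityʳ; +-mono-≤; ≤-trans; ≤-antisym; module ≤-Reasoning)
open import Data.Fin using (Fin; fromℕ<; inject₁; punchIn; _≟_) renaming (zero to fzero; suc to fsuc)
open import Data.Fin.Properties using (toℕ-inject₁; punchInᵢ≢i)
open import Data.Fin.Induction using (<-weakInduction)
open import Data.Fin.Subset using (Subset; ∣_∣; _∈_; _⊆_; _∩_)
open import Data.Fin.Subset.Properties using (x∈p∩q⁺; x∈p∩q⁻; p∩q⊆q; p⊆q⇒∣p∣≤∣q∣)
open import Data.Vec using ([]; _∷_; sum; tabulate; lookup)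
open import Data.Vec.Properties using (lookup∘tabulate; []=⇒lookup; lookup⇒[]=)
open import Data.Bool using (Bool; true; false)
open import Data.Product using (_×_; _,_; proj₁; proj₂)
open import Data.Sum using (inj₁; inj₂)
open import Data.Unit using (⊤; tt)
open import Data.Empty using (⊥-elim)
open import Function using (_∘_)
open import Relation.Nullary using (yes; no)
open import Relation.Nullary.Decidable using (does; dec-true)
open import Relation.Binary.PropositionalEquality
  using (_≡_; _≢_; refl; sym; trans; cong; subst; module ≡-Reasoning)
open import Relation.Binary.Construct.Closure.ReflexiveTransitive using (ε; _◅_)
open import Algebra.Properties.CommutativeMonoid.Sum +-0-commutativeMonoid
  using (sum-cong-≗; sum-remove; sum-replicate-zero; ∑-comm)
  renaming (sum to ∑)

sum-tabulate : ∀ {n} (f : Fin n → ℕ) → sum (tabulate f) ≡ ∑ f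
sum-tabulate {zero}  f = refl
sum-tabulate {suc n} f = cong (f fzero +_) (sum-tabulate (f ∘ fsuc))

∑-mono-≤ : ∀ {n} {f g : Fin n → ℕ} → (∀ i → f i ≤ g i) → ∑ f ≤ ∑ g
∑-mono-≤ {zero}  f≤g = z≤n
∑-mono-≤ {suc n} f≤g = +-mono-≤ (f≤g fzero) (∑-mono-≤ (f≤g ∘ fsuc))

∑-supported-at : ∀ {n} (f : Fin n → ℕ) (j : Fin n) → (∀ i → i ≢ j → f i ≡ 0) → ∑ f ≡ f j
∑-supported-at {suc n} f j vanishes = begin
  ∑ f                           ≡⟨ sum-remove {i = j} f ⟩
  f j + ∑ (f ∘ punchIn j)       ≡⟨ cong (f j +_) (sum-cong-≗ λ i → vanishes _ (punchInᵢ≢i j i)) ⟩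
  f j + ∑ {n} (λ _ → 0)         ≡⟨ cong (f j +_) (sum-replicate-zero n) ⟩
  f j + 0                       ≡⟨ +-identityʳ (f j) ⟩
  f j                           ∎
  where open ≡-Reasoning

indicator : Bool → ℕ
indicator true  = 1
indicator false = 0

∣p∣≡∑indicator : ∀ {k} (p : Subset k) → ∣ p ∣ ≡ ∑ (indicator ∘ lookup p)
∣p∣≡∑indicator []          = refl
∣p∣≡∑indicator (true ∷ p)  = cong suc (∣p∣≡∑indicator p)
∣p∣≡∑indicator (false ∷ p) = ∣p∣≡∑indicator p

consecutive-constant : ∀ {l} {I : Set} (f : Fin l → I) →
                       (∀ i j → Consec i j → f i ≡ f j) → ∀ i j → f i ≡ f j
consecutive-constant {suc l} f step i j = trans (≡f₀ i) (sym (≡f₀ j))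
  where
  ≡f₀ : ∀ i → f i ≡ f fzero
  ≡f₀ = <-weakInduction (λ i → f i ≡ f fzero) refl λ i fi≡f₀ →
    trans (sym (step (inject₁ i) (fsuc i) (inj₁ (cong suc (sym (toℕ-inject₁ i)))))) fi≡f₀

module _ {V : Set} {adj : V → V → Set} where

  Cycle-rekeep : ∀ {keep keep′ : V → Set} (c : Cycle adj keep) →
                 (∀ i → keep′ (Cycle.vtx c i)) → Cycle adj keep′
  Cycle-rekeep c kept′ = record { Cycle c hiding (kept) ; kept = kept′ }

  InducedChordal-anti : ∀ {keep keep′ : V → Set} → (∀ {v} → keep′ v → keep v) →
                        InducedChordal adj keep → InducedChordal adj keep′
  InducedChordal-anti keep′⊆keep chordal c = chordal (Cycle-rekeep c (keep′⊆keep ∘ Cycle.kept c))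

  InducedChordal-fromClasses : ∀ {I : Set} {keep : V → Set} (φ : V → I) →
                               (∀ {u v} → adj u v → φ u ≡ φ v) →
                               (∀ i → InducedChordal adj (λ v → φ v ≡ i × keep v)) →
                               InducedChordal adj keep
  InducedChordal-fromClasses φ adj⇒≡ chordalᵢ c =
    chordalᵢ (φ (vtx v₀)) (Cycle-rekeep c λ i → φvtx-constant i v₀ , kept i)
    where
    open Cycle c
    v₀ : Fin len
    v₀ = fromℕ< (≤-trans (s≤s z≤n) len≥4)
    φvtx-constant : ∀ i j → φ (vtx i) ≡ φ (vtx j)
    φvtx-constant = consecutive-constant (φ ∘ vtx) λ i j → adj⇒≡ ∘ edges i j

∈-tabulate⁺ : ∀ {k} {f : Fin k → Bool} {a} → f a ≡ true → a ∈ tabulate f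
∈-tabulate⁺ {f = f} {a} fa≡true = lookup⇒[]= a (tabulate f) (trans (lookup∘tabulate f a) fa≡true)

∈-tabulate⁻ : ∀ {k} {f : Fin k → Bool} {a} → a ∈ tabulate f → f a ≡ true
∈-tabulate⁻ {f = f} {a} a∈ = trans (sym (lookup∘tabulate f a)) ([]=⇒lookup a∈)

module Fibres {k t : ℕ} (label : Fin k → Fin t) where

  fibre : Fin t → Subset k
  fibre i = tabulate (λ a → does (label a ≟ i))

  ∈-fibre⁺ : ∀ {a i} → label a ≡ i → a ∈ fibre i
  ∈-fibre⁺ {a} {i} eq = ∈-tabulate⁺ (dec-true (label a ≟ i) eq)

  ∈-fibre⁻ : ∀ {a i} → a ∈ fibre i → label a ≡ i
  ∈-fibre⁻ {a} {i} a∈ with label a ≟ i | ∈-tabulate⁻ {f = λ a → does (label a ≟ i)} a∈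
  ... | yes eq | _ = eq
  ... | no _   | ()

  glue : (Fin t → Subset k) → Subset k
  glue g = tabulate (λ a → lookup (g (label a)) a)

  ∈-glue⁺ : ∀ g {a i} → label a ≡ i → a ∈ g i → a ∈ glue g
  ∈-glue⁺ _ refl a∈ = ∈-tabulate⁺ ([]=⇒lookup a∈)

  ∈-glue⁻ : ∀ g {a} → a ∈ glue g → a ∈ g (label a)
  ∈-glue⁻ g {a} a∈ = lookup⇒[]= a (g (label a)) (∈-tabulate⁻ a∈)

  glue-∩-fibre⊆ : ∀ F → glue (λ i → F ∩ fibre i) ⊆ F
  glue-∩-fibre⊆ F = proj₁ ∘ x∈p∩q⁻ F _ ∘ ∈-glue⁻ (λ i → F ∩ fibre i)

  ∣glue∣≡∑ : ∀ g → (∀ i → g i ⊆ fibre i) → ∣ glue g ∣ ≡ ∑ (λ i → ∣ g i ∣)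
  ∣glue∣≡∑ g g⊆fibre = begin
    ∣ glue g ∣                                         ≡⟨ ∣p∣≡∑indicator (glue g) ⟩
    ∑ (λ a → indicator (lookup (glue g) a))            ≡⟨ sum-cong-≗ (cong indicator ∘ lookup∘tabulate (λ a → lookup (g (label a)) a)) ⟩
    ∑ (λ a → indicator (lookup (g (label a)) a))       ≡⟨ sum-cong-≗ (λ a → sym (∑-supported-at _ (label a) (off-fibre a))) ⟩
    ∑ (λ a → ∑ (λ i → indicator (lookup (g i) a)))     ≡⟨ ∑-comm (λ i a → indicator (lookup (g i) a)) ⟨
    ∑ (λ i → ∑ (λ a → indicator (lookup (g i) a)))     ≡⟨ sum-cong-≗ (∣p∣≡∑indicator ∘ g) ⟨
    ∑ (λ i → ∣ g i ∣)                                  ∎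
    where
    open ≡-Reasoning
    off-fibre : ∀ a i → i ≢ label a → indicator (lookup (g i) a) ≡ 0
    off-fibre a i i≢label with lookup (g i) a in eq
    ... | true  = ⊥-elim (i≢label (sym (∈-fibre⁻ (g⊆fibre i (lookup⇒[]= a (g i) eq)))))
    ... | false = refl

module _ {n m k : ℕ} (G : EdgeColoredGraph n m k) where
  open EdgeColoredGraph G

  Conflict⇒ColorConnected : ∀ {e f} → Conflict G e f → ColorConnected G (col e) (col f)
  Conflict⇒ColorConnected {e} {f} conflict with col e ≟ col f | conflict
  ... | yes same      | _                  = subst (ColorConnected G (col e)) same ε
  ... | no  different | _ , inj₁ shareEnd  = (different , e , f , refl , refl , shareEnd) ◅ ε
  ... | no  different | _ , inj₂ same      = ⊥-elim (different same)

  module _ {t : ℕ} (label : Fin k → Fin t)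
           (conflict⇒sameLabel : ∀ {e f} → Conflict G e f → label (col e) ≡ label (col f)) where
    open Fibres label

    glue-works : ∀ Fs → (∀ i → DeletionWorks G (λ a → label a ≡ i) (Fs i)) →
                 DeletionWorks G (λ _ → ⊤) (glue Fs)
    glue-works Fs works =
        (λ _ _ → tt)
      , InducedChordal-fromClasses (label ∘ col) conflict⇒sameLabel λ i →
          InducedChordal-anti (λ (eq , _ , ∉glue) → eq , ∉glue ∘ ∈-glue⁺ Fs eq) (proj₂ (works i))

    ∩-fibre-works : ∀ {F} → DeletionWorks G (λ _ → ⊤) F →
                    ∀ i → DeletionWorks G (λ a → label a ≡ i) (F ∩ fibre i)
    ∩-fibre-works {F} works i =
        (λ _ → ∈-fibre⁻ ∘ p∩q⊆q F (fibre i))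
      , InducedChordal-anti (λ (eq , ∉F∩fibre) → tt , λ ∈F → ∉F∩fibre (x∈p∩q⁺ (∈F , ∈-fibre⁺ eq)))
                            (proj₂ works)

    deletionNumber-additive : ∀ {κ κs} → IsChordalDeletionNumber G (λ _ → ⊤) κ →
                              (∀ i → IsChordalDeletionNumber G (λ a → label a ≡ i) (κs i)) →
                              κ ≡ ∑ κs
    deletionNumber-additive {κ} {κs} ((F , F-works , ∣F∣≡κ) , κ-minimal) κsᵢ =
      ≤-antisym κ≤∑κs ∑κs≤κ
      where
      open ≤-Reasoning
      Fs : Fin t → Subset k
      Fs i = proj₁ (proj₁ (κsᵢ i))
      Fs-works : ∀ i → DeletionWorks G (λ a → label a ≡ i) (Fs i)
      Fs-works i = proj₁ (proj₂ (proj₁ (κsᵢ i)))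

      κ≤∑κs : κ ≤ ∑ κs
      κ≤∑κs = begin
        κ                  ≤⟨ κ-minimal (glue Fs) (glue-works Fs Fs-works) ⟩
        ∣ glue Fs ∣        ≡⟨ ∣glue∣≡∑ Fs (λ i → ∈-fibre⁺ ∘ proj₁ (Fs-works i) _) ⟩
        ∑ (λ i → ∣ Fs i ∣) ≡⟨ sum-cong-≗ (λ i → proj₂ (proj₂ (proj₁ (κsᵢ i)))) ⟩
        ∑ κs               ∎

      ∑κs≤κ : ∑ κs ≤ κ
      ∑κs≤κ = begin
        ∑ κs                          ≤⟨ ∑-mono-≤ (λ i → proj₂ (κsᵢ i) _ (∩-fibre-works F-works i)) ⟩
        ∑ (λ i → ∣ F ∩ fibre i ∣)     ≡⟨ ∣glue∣≡∑ (λ i → F ∩ fibre i) (λ i → p∩q⊆q F (fibre i)) ⟨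
        ∣ glue (λ i → F ∩ fibre i) ∣  ≤⟨ p⊆q⇒∣p∣≤∣q∣ (glue-∩-fibre⊆ F) ⟩
        ∣ F ∣                         ≡⟨ ∣F∣≡κ ⟩
        κ                             ∎

mainTheorem10 : {n m k : ℕ} (G : EdgeColoredGraph n m k) (t : ℕ) (comp : Fin k → Fin t)
    → IsComponentLabelling G t comp
    → ((e f : Fin m) → Conflict G e f
         → comp (EdgeColoredGraph.col G e) ≡ comp (EdgeColoredGraph.col G f))
    × ((κ : ℕ) (κs : Fin t → ℕ)
         → IsChordalDeletionNumber G (λ _ → ⊤) κ
         → ((i : Fin t) → IsChordalDeletionNumber G (λ a → comp a ≡ i) (κs i))
         → κ ≡ sum (tabulate κs))
mainTheorem10 G t comp (_ , _ , connected⇒sameComp) =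
    conflict⇒sameComp
  , λ κ κs κ-opt κsᵢ-opt →
      trans (deletionNumber-additive G comp (conflict⇒sameComp _ _) κ-opt κsᵢ-opt)
            (sym (sum-tabulate κs))
  where
  conflict⇒sameComp : ∀ e f → Conflict G e f
                      → comp (EdgeColoredGraph.col G e) ≡ comp (EdgeColoredGraph.col G f)
  conflict⇒sameComp _ _ = connected⇒sameComp _ _ ∘ Conflict⇒ColorConnected G
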